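{- Let $G$ be a graph on $n$ vertices with treewidth $t$, and let $(\{X_i : i \in I\}, r, T)$ be a normalized tree decomposition of $G$ of width $t$. Then there exists $l \in I$ such that the graph $G \setminus X_l$ (induced on $V(G)\setminus X_l$) is a disjoint union $G_1 \uplus G_2 \uplus G_3$ of three (possibly empty) subgraphs with no edges between them, satisfying $|V(G_i)| \leq \frac12\,(n - |X_l| + 1)$ for each $i \in \{1,2,3\}$.
   Context: A tree decomposition of $G$ is a pair $(\{X_i : i\in I\}, T)$ where $T$ is a tree with node set $I$ and each $X_i \subseteq V(G)$, such that (1) $\bigcup_{i\in I} X_i = V(G)$; (2) for every edge $\{u,v\}$ of $G$ there is $i$ with $u,v \in X_i$; (3) for all $i,j,k \in I$, if $j$ lies on the path in $T$ from $i$ to $k$ then $X_i \cap X_k \subseteq X_j$. Its width is $\max_i |X_i| - 1$, and the treewidth of $G$ is the minimum width of a tree decomposition. A normalized tree decomposition is a triple $(\{X_i : i \in I\}, r, T)$ where $(\{X_i\},T)$ is a tree decomposition, $T$ is rooted at $r \in I$ with $|X_r| = 1$, and for every node $i$ and every child $i'$ of $i$, the symmetric difference of $X_{i'}$ and $X_i$ has exactly one element. -}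

module Defs where

open import Data.Nat using (ℕ; suc; _+_; _*_; _∸_; _≤_; _<_)
open import Data.Fin using (Fin)
open import Data.Fin.Subset using (Subset; _∈_; _∉_; _∪_; _─_; ∣_∣)
open import Data.Bool using (Bool; true; false)
open import Data.List using (List; []; _∷_; length)
open import Data.List.Relation.Unary.Unique.Propositional using (Unique)
import Data.List.Membership.Propositional as L
open import Data.Product using (Σ; ∃; _×_)
open import Data.Sum using (_⊎_)
open import Relation.Nullary using (¬_)
open import Relation.Binary.PropositionalEquality using (_≡_)

record Graph (n : ℕ) : Set where
  field
    Adj    : Fin n → Fin n → Bool
    sym    : ∀ u v → Adj u v ≡ Adj v u
    irrefl : ∀ v → Adj v v ≡ false

open Graph public

Edge : ∀ {n} → Graph n → Fin n → Fin n → Set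
Edge G u v = Adj G u v ≡ true

data PathFrom {n : ℕ} (G : Graph n) : Fin n → Fin n → List (Fin n) → Set where
  here : ∀ u → PathFrom G u u (u ∷ [])
  step : ∀ {u v w p} → Edge G u v → PathFrom G v w p → PathFrom G u w (u ∷ p)

SimplePath : ∀ {n} → Graph n → Fin n → Fin n → List (Fin n) → Set
SimplePath G u w p = PathFrom G u w p × Unique p

Connected : ∀ {n} → Graph n → Set
Connected G = ∀ u w → ∃ λ p → PathFrom G u w p

HasCycle : ∀ {n} → Graph n → Set
HasCycle G = Σ _ λ u → Σ _ λ w → Σ _ λ p →
  SimplePath G u w p × (3 ≤ length p) × Edge G w u

IsTree : ∀ {m} → Graph m → Set
IsTree {m} T = (1 ≤ m) × Connected T × ¬ HasCycle T

OnPath : ∀ {m} → Graph m → Fin m → Fin m → Fin m → Set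
OnPath T i k j = ∃ λ p → SimplePath T i k p × j L.∈ p

record TreeDecomposition {n : ℕ} (G : Graph n) : Set where
  field
    m         : ℕ
    T         : Graph m
    tree      : IsTree T
    X         : Fin m → Subset n
    cover     : ∀ v → ∃ λ i → v ∈ X i
    edgeCover : ∀ u v → Edge G u v → ∃ λ i → (u ∈ X i) × (v ∈ X i)
    coherent  : ∀ i j k → OnPath T i k j → ∀ v → v ∈ X i → v ∈ X k → v ∈ X j

open TreeDecomposition public

-- width D = t, i.e. max_i |X_i| - 1 = t, i.e. max_i |X_i| = t + 1
HasWidth : ∀ {n} {G : Graph n} → TreeDecomposition G → ℕ → Set
HasWidth D t = (∀ i → ∣ X D i ∣ ≤ suc t) × (∃ λ i → ∣ X D i ∣ ≡ suc t)

WidthAtLeast : ∀ {n} {G : Graph n} → TreeDecomposition G → ℕ → Set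
WidthAtLeast D t = ∃ λ i → suc t ≤ ∣ X D i ∣

HasTreewidth : ∀ {n} → Graph n → ℕ → Set
HasTreewidth G t =
  (∃ λ (D : TreeDecomposition G) → HasWidth D t) ×
  (∀ (D : TreeDecomposition G) → WidthAtLeast D t)

ChildOf : ∀ {m} → Graph m → Fin m → Fin m → Fin m → Set
ChildOf T r i i' = Edge T i i' × OnPath T r i' i

IsNormalized : ∀ {n} {G : Graph n} (D : TreeDecomposition G) → Fin (m D) → Set
IsNormalized D r =
  (∣ X D r ∣ ≡ 1) ×
  (∀ i i' → ChildOf (T D) r i i' →
     ∣ (X D i' ─ X D i) ∪ (X D i ─ X D i') ∣ ≡ 1)

ThreeSplit : ∀ {n} → Graph n → Subset n → Subset n → Subset n → Subset n → Set
ThreeSplit G Y S₁ S₂ S₃ =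
  (∀ v → v ∉ Y → (v ∈ S₁ ⊎ v ∈ S₂ ⊎ v ∈ S₃)) ×
  (∀ v → v ∈ S₁ → v ∉ Y) × (∀ v → v ∈ S₂ → v ∉ Y) × (∀ v → v ∈ S₃ → v ∉ Y) ×
  (∀ v → v ∈ S₁ → v ∉ S₂) × (∀ v → v ∈ S₁ → v ∉ S₃) × (∀ v → v ∈ S₂ → v ∉ S₃) ×
  (∀ u v → u ∈ S₁ → v ∈ S₂ → ¬ Edge G u v) ×
  (∀ u v → u ∈ S₁ → v ∈ S₃ → ¬ Edge G u v) ×
  (∀ u v → u ∈ S₂ → v ∈ S₃ → ¬ Edge G u v)

module Submission where

-- For a node i of the tree T and a neighbour j of i, let Beyond i j be the
-- set of vertices outside the bag X_i whose bags lie in the branch of T at i through j.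
-- Call the branch heavy when 2|Beyond i j| > n - |X_i| + 1.  Three facts drive the proof:
--   * the sets Beyond i j (j ranging over the neighbours of i) partition V(G) \ X_i and no
--     edge of G joins two of them (coherence of the decomposition);
--   * two neighbours i, j are never heavy towards each other: their bags differ in one
--     vertex (normalization), which leaves too little room for both halves;
--   * following heavy branches therefore never turns back, so the branch shrinks at each
--     step and the walk stops at a node l with no heavy branch.
-- Finally the parts Beyond l j, each of size at most (n - |X_l| + 1)/2, are grouped into
-- three: those with index below a threshold s, the one with index s, and those above s.

open import Defs
open import Data.Nat using (ℕ; zero; suc; _+_; _*_; _∸_; _≤_; _<_; z≤n; s≤s; _<?_)
open import Data.Nat.Properties
open import Data.Nat.Tactic.RingSolver using (solve-∀)
open import Data.Fin using (Fin; toℕ; fromℕ<) renaming (_≟_ to _≟ᶠ_)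
open import Data.Fin.Properties using (any?; toℕ-injective; toℕ<n; toℕ-fromℕ<)
open import Data.Fin.Subset using (Subset; _∈_; _∉_; _⊆_; _∪_; _∩_; _─_; ∁; ∣_∣)
open import Data.Fin.Subset.Properties
  using (_∈?_; nonempty?; Empty-unique; ∣⊥∣≡0; p⊆q⇒∣p∣≤∣q∣; p⊂q⇒∣p∣<∣q∣; x∈p∪q⁻;
         x∉p⇒x∈∁p; ∣∁p∣≡n∸∣p∣; ∪-comm; x∈p∩q⁻)
open import Data.Bool using (true; false)
open import Data.Vec using ([]; _∷_; tabulate; here; there)
open import Data.Vec.Properties using (lookup∘tabulate; []=⇒lookup; lookup⇒[]=)
open import Data.List using (List; []; _∷_; _++_; [_]; reverse)
open import Data.List.Properties using (unfold-reverse)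
open import Data.List.Relation.Unary.All as All using (All; []; _∷_)
open import Data.List.Relation.Unary.All.Properties using (¬Any⇒All¬; anti-mono)
open import Data.List.Relation.Unary.Any as Any using (here; there)
open import Data.List.Relation.Unary.Any.Properties using (reverse⁺; reverse⁻)
open import Data.List.Membership.Propositional using (find) renaming (_∈_ to _∈ₗ_)
open import Data.List.Membership.Propositional.Properties using (∈-++⁺ˡ)
import Data.List.Membership.DecPropositional as DecMembership
open import Data.List.Relation.Unary.AllPairs using ([]; _∷_)
open import Data.List.Relation.Unary.Unique.Propositional using (Unique)
open import Data.List.Relation.Unary.Unique.Propositional.Properties using (++⁺)
open import Data.Product using (Σ; ∃; _×_; _,_; proj₁; proj₂)
open import Data.Sum using (_⊎_; inj₁; inj₂; [_,_]′)
open import Data.Empty using (⊥; ⊥-elim)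
open import Function using (_∘_; id)
open import Relation.Nullary using (¬_; Dec; yes; no; does; contradiction)
open import Relation.Nullary.Decidable using (dec-true; _×-dec_; ¬?)
open import Relation.Binary using (tri<; tri≈; tri>)
open import Relation.Binary.PropositionalEquality
  using (_≡_; _≢_; refl; trans; cong; subst)
  renaming (sym to ≡-sym)

select : ∀ {n} {P : Fin n → Set} → (∀ v → Dec (P v)) → Subset n
select P? = tabulate (λ v → does (P? v))

select⁺ : ∀ {n} {P : Fin n → Set} (P? : ∀ v → Dec (P v)) {v} → P v → v ∈ select P?
select⁺ P? {v} pv = lookup⇒[]= v _ (trans (lookup∘tabulate _ v) (dec-true (P? v) pv))

select⁻ : ∀ {n} {P : Fin n → Set} (P? : ∀ v → Dec (P v)) {v} → v ∈ select P? → P v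
select⁻ P? {v} v∈ with P? v | trans (≡-sym (lookup∘tabulate _ v)) ([]=⇒lookup v∈)
... | yes pv | _  = pv
... | no _   | ()

∣empty∣≡0 : ∀ {n} (p : Subset n) → (∀ v → v ∉ p) → ∣ p ∣ ≡ 0
∣empty∣≡0 {n} p none = trans (cong ∣_∣ (Empty-unique (λ (v , v∈p) → none v v∈p))) (∣⊥∣≡0 n)

element : ∀ {n} (p : Subset n) → 0 < ∣ p ∣ → ∃ λ v → v ∈ p
element p pos with nonempty? p
... | yes ne    = ne
... | no empty = contradiction (∣empty∣≡0 p (λ v v∈p → empty (v , v∈p))) (>⇒≢ pos)

∣p∪q∣≡∣p∣+∣q∣ : ∀ {n} (p q : Subset n) → (∀ {v} → v ∈ p → v ∉ q) → ∣ p ∪ q ∣ ≡ ∣ p ∣ + ∣ q ∣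
∣p∪q∣≡∣p∣+∣q∣ []          []          _    = refl
∣p∪q∣≡∣p∣+∣q∣ (true ∷ p)  (true ∷ q)  disj = contradiction here (disj here)
∣p∪q∣≡∣p∣+∣q∣ (true ∷ p)  (false ∷ q) disj =
  cong suc (∣p∪q∣≡∣p∣+∣q∣ p q (λ v∈p v∈q → disj (there v∈p) (there v∈q)))
∣p∪q∣≡∣p∣+∣q∣ (false ∷ p) (true ∷ q)  disj =
  trans (cong suc (∣p∪q∣≡∣p∣+∣q∣ p q (λ v∈p v∈q → disj (there v∈p) (there v∈q))))
        (≡-sym (+-suc ∣ p ∣ ∣ q ∣))
∣p∪q∣≡∣p∣+∣q∣ (false ∷ p) (false ∷ q) disj =
  ∣p∪q∣≡∣p∣+∣q∣ p q (λ v∈p v∈q → disj (there v∈p) (there v∈q))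

disjoint-size : ∀ {n} (p q r : Subset n) → p ⊆ r → q ⊆ r → (∀ {v} → v ∈ p → v ∉ q) →
                ∣ p ∣ + ∣ q ∣ ≤ ∣ r ∣
disjoint-size p q r p⊆r q⊆r disj = begin
  ∣ p ∣ + ∣ q ∣ ≡⟨ ≡-sym (∣p∪q∣≡∣p∣+∣q∣ p q disj) ⟩
  ∣ p ∪ q ∣     ≤⟨ p⊆q⇒∣p∣≤∣q∣ (λ v∈ → [ p⊆r , q⊆r ]′ (x∈p∪q⁻ p q v∈)) ⟩
  ∣ r ∣         ∎
  where open ≤-Reasoning

-- Arithmetic bookkeeping for a position that is counted twice on both sides.
private
  two-more : ∀ {x y d} → y ≡ 2 + x → x ≡ d + d → y ≡ suc d + suc d
  two-more {d = d} y≡ x≡ = trans y≡ (trans (cong (2 +_) x≡) (double-suc d))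
    where double-suc : ∀ d → 2 + (d + d) ≡ suc d + suc d
          double-suc = solve-∀

  shift₁ : ∀ a b c → a + suc b + suc c ≡ 2 + (a + b + c)
  shift₁ = solve-∀

  shift₂ : ∀ a b c → suc a + b + suc c ≡ 2 + (a + b + c)
  shift₂ = solve-∀

  shift₃ : ∀ a b c → suc a + suc b + c ≡ 2 + (a + b + c)
  shift₃ = solve-∀

-- Counting complements: an element outside p ∩ q is missed by p or by q, and by both
-- exactly when it lies outside the symmetric difference of p and q.
∣∁p∣+∣∁q∣+∣p△q∣ : ∀ {n} (p q : Subset n) →
  ∣ ∁ p ∣ + ∣ ∁ q ∣ + ∣ (q ─ p) ∪ (p ─ q) ∣ ≡ ∣ ∁ (p ∩ q) ∣ + ∣ ∁ (p ∩ q) ∣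
∣∁p∣+∣∁q∣+∣p△q∣ []          []          = refl
∣∁p∣+∣∁q∣+∣p△q∣ (true ∷ p)  (true ∷ q)  = ∣∁p∣+∣∁q∣+∣p△q∣ p q
∣∁p∣+∣∁q∣+∣p△q∣ (true ∷ p)  (false ∷ q) =
  two-more (shift₁ (∣ ∁ p ∣) (∣ ∁ q ∣) (∣ (q ─ p) ∪ (p ─ q) ∣)) (∣∁p∣+∣∁q∣+∣p△q∣ p q)
∣∁p∣+∣∁q∣+∣p△q∣ (false ∷ p) (true ∷ q)  =
  two-more (shift₂ (∣ ∁ p ∣) (∣ ∁ q ∣) (∣ (q ─ p) ∪ (p ─ q) ∣)) (∣∁p∣+∣∁q∣+∣p△q∣ p q)
∣∁p∣+∣∁q∣+∣p△q∣ (false ∷ p) (false ∷ q) =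
  two-more (shift₃ (∣ ∁ p ∣) (∣ ∁ q ∣) (∣ (q ─ p) ∪ (p ─ q) ∣)) (∣∁p∣+∣∁q∣+∣p△q∣ p q)

Fits : ∀ {n} → Subset n → Subset n → Set
Fits Y S = 2 * ∣ S ∣ ≤ ∣ ∁ Y ∣ + 1

Heavy : ∀ {n} → Subset n → Subset n → Set
Heavy Y S = ∣ ∁ Y ∣ + 1 < 2 * ∣ S ∣

heavy? : ∀ {n} (Y S : Subset n) → Dec (Heavy Y S)
heavy? Y S = ∣ ∁ Y ∣ + 1 <? 2 * ∣ S ∣

empty-fits : ∀ {n} (Y S : Subset n) → (∀ v → v ∉ S) → Fits Y S
empty-fits Y S none rewrite ∣empty∣≡0 S none = z≤n

heavy-element : ∀ {n} (Y S : Subset n) → Heavy Y S → ∃ λ v → v ∈ S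
heavy-element Y S heavy = element S (positive ∣ S ∣ heavy)
  where positive : ∀ x {y} → y < 2 * x → 0 < x
        positive zero    ()
        positive (suc x) _  = s≤s z≤n

-- Two disjoint parts A, B outside bags P, Q that differ in a single vertex cannot both
-- be heavy: together they would need more than the room outside P ∩ Q.
not-both-heavy : ∀ {n} (P Q A B : Subset n) → ∣ (Q ─ P) ∪ (P ─ Q) ∣ ≡ 1 →
  (∀ {v} → v ∈ A → v ∉ P) → (∀ {v} → v ∈ B → v ∉ Q) → (∀ {v} → v ∈ A → v ∉ B) →
  Heavy P A → Heavy Q B → ⊥
not-both-heavy P Q A B one A∌P B∌Q disj heavyA heavyB = <-irrefl refl (begin-strict
  a + b + 1                 <⟨ m<m+n (a + b + 1) {3} (s≤s z≤n) ⟩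
  a + b + 1 + 3             ≡⟨ regroup a b ⟩
  suc (a + 1) + suc (b + 1) ≤⟨ +-mono-≤ heavyA heavyB ⟩
  2 * ∣ A ∣ + 2 * ∣ B ∣      ≡⟨ ≡-sym (*-distribˡ-+ 2 ∣ A ∣ ∣ B ∣) ⟩
  2 * (∣ A ∣ + ∣ B ∣)        ≤⟨ *-monoʳ-≤ 2 (disjoint-size A B (∁ (P ∩ Q)) avoid₁ avoid₂ disj) ⟩
  2 * k                     ≡⟨ cong (k +_) (+-identityʳ k) ⟩
  k + k                     ≡⟨ ≡-sym room ⟩
  a + b + 1                 ∎)
  where
  open ≤-Reasoning
  a = ∣ ∁ P ∣
  b = ∣ ∁ Q ∣
  k = ∣ ∁ (P ∩ Q) ∣
  room : a + b + 1 ≡ k + k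
  room = trans (cong (a + b +_) (≡-sym one)) (∣∁p∣+∣∁q∣+∣p△q∣ P Q)
  avoid₁ : A ⊆ ∁ (P ∩ Q)
  avoid₁ v∈A = x∉p⇒x∈∁p (A∌P v∈A ∘ proj₁ ∘ x∈p∩q⁻ P Q)
  avoid₂ : B ⊆ ∁ (P ∩ Q)
  avoid₂ v∈B = x∉p⇒x∈∁p (B∌Q v∈B ∘ proj₂ ∘ x∈p∩q⁻ P Q)
  regroup : ∀ a b → a + b + 1 + 3 ≡ suc (a + 1) + suc (b + 1)
  regroup = solve-∀

rest-fits : ∀ {n} (Y A B : Subset n) → A ⊆ ∁ Y → B ⊆ ∁ Y → (∀ {v} → v ∈ B → v ∉ A) →
  Heavy Y B → Fits Y A
rest-fits Y A B A⊆ B⊆ disj heavy =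
  ≤-trans (m≤m+n (2 * a) 2) (≤-trans (+-cancelʳ-≤ N (2 * a + 2) N chain) (m≤m+n N 1))
  where
  open ≤-Reasoning
  a = ∣ A ∣
  N = ∣ ∁ Y ∣
  chain : 2 * a + 2 + N ≤ N + N
  chain = begin
    2 * a + 2 + N           ≡⟨ regroup a N ⟩
    2 * a + suc (N + 1)     ≤⟨ +-monoʳ-≤ (2 * a) heavy ⟩
    2 * a + 2 * ∣ B ∣        ≡⟨ ≡-sym (*-distribˡ-+ 2 a ∣ B ∣) ⟩
    2 * (a + ∣ B ∣)          ≡⟨ cong (2 *_) (+-comm a ∣ B ∣) ⟩
    2 * (∣ B ∣ + a)          ≤⟨ *-monoʳ-≤ 2 (disjoint-size B A (∁ Y) B⊆ A⊆ disj) ⟩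
    2 * N                   ≡⟨ cong (N +_) (+-identityʳ N) ⟩
    N + N                   ∎
    where regroup : ∀ a N → 2 * a + 2 + N ≡ 2 * a + suc (N + 1)
          regroup = solve-∀

unique-reverse : ∀ {A : Set} {xs : List A} → Unique xs → Unique (reverse xs)
unique-reverse {xs = []}     []        = []
unique-reverse {xs = x ∷ xs} (x∉ ∷ u) rewrite unfold-reverse x xs =
  ++⁺ (unique-reverse u) ([] ∷ []) λ { (x∈ , here refl) → All.lookup x∉ (reverse⁻ x∈) refl }

_∈ₗ?_ : ∀ {k} (x : Fin k) (xs : List (Fin k)) → Dec (x ∈ₗ xs)
_∈ₗ?_ = DecMembership._∈?_ _≟ᶠ_

module Paths {k : ℕ} (T : Graph k) where

  edge-sym : ∀ {u v} → Edge T u v → Edge T v u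
  edge-sym {u} {v} e = trans (sym T v u) e

  edge-irrefl : ∀ {u v} → Edge T u v → u ≢ v
  edge-irrefl {u} e refl with trans (≡-sym e) (irrefl T u)
  ... | ()

  path-last : ∀ {u w p} → PathFrom T u w p → w ∈ₗ p
  path-last (here _)   = here refl
  path-last (step _ P) = there (path-last P)

  trivial-path : ∀ {j q} → PathFrom T j q (j ∷ []) → q ≡ j
  trivial-path (here _) = refl

  uncons : ∀ {i j q p} → PathFrom T i q (i ∷ j ∷ p) → Edge T i j × PathFrom T j q (j ∷ p)
  uncons (step e (here _))   = e , here _
  uncons (step e (step e′ P)) = e , step e′ P

  append : ∀ {a b c d p q} → PathFrom T a b p → Edge T b c → PathFrom T c d q →
           PathFrom T a d (p ++ q)
  append (here _)    e Q = step e Q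
  append (step e′ P) e Q = step e′ (append P e Q)

  reverse-path : ∀ {a b p} → PathFrom T a b p → PathFrom T b a (reverse p)
  reverse-path (here a) = here a
  reverse-path (step {u = u} {p = p} e P) rewrite unfold-reverse u p =
    append (reverse-path P) (edge-sym e) (here u)

  prefix : ∀ {a b x p} → PathFrom T a b p → Unique p → x ∈ₗ p →
           ∃ λ s → PathFrom T a x s × Unique s × (∀ {y} → y ∈ₗ s → y ∈ₗ p)
  prefix (here a)   u (here refl) = _ , here a , u , id
  prefix (step e P) u (here refl) = _ , here _ , [] ∷ [] , λ { (here refl) → here refl }
  prefix (step e P) (a∉ ∷ u) (there x∈) with prefix P u x∈
  ... | s , S , us , s⊆ =
    _ , step e S , anti-mono s⊆ a∉ ∷ us , λ { (here refl) → here refl ; (there y∈) → there (s⊆ y∈) }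

  suffix : ∀ {a b x p} → PathFrom T a b p → Unique p → x ∈ₗ p → ∃ λ s → SimplePath T x b s
  suffix (here a)   u        (here refl) = _ , here a , u
  suffix (step e P) u        (here refl) = _ , step e P , u
  suffix (step e P) (_ ∷ u) (there x∈)  = suffix P u x∈

  to-simple : ∀ {a b p} → PathFrom T a b p → ∃ λ s → SimplePath T a b s
  to-simple (here a) = _ , here a , [] ∷ []
  to-simple (step {u = a} e P) with to-simple P
  ... | s , S , us with a ∈ₗ? s
  ...   | yes a∈s = suffix S us a∈s
  ...   | no  a∉s = _ , step e S , ¬Any⇒All¬ s a∉s ∷ us

  Branch : Fin k → Fin k → Fin k → Set
  Branch i j q = ∃ λ p → SimplePath T i q (i ∷ j ∷ p)

  branch-edge : ∀ {i j q} → Branch i j q → Edge T i j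
  branch-edge (_ , P , _) = proj₁ (uncons P)

  branch-source : ∀ {i j q} → Branch i j q → q ≢ i
  branch-source (_ , P , i∉ ∷ _) q≡i =
    All.lookup i∉ (path-last (proj₂ (uncons P))) (≡-sym q≡i)

  branch-neighbour : ∀ {i j} → Edge T i j → Branch i j j
  branch-neighbour e = [] , step e (here _) , (edge-irrefl e ∷ []) ∷ [] ∷ []

  branch-cons : ∀ {i j q s} → Edge T i j → PathFrom T j q s → All (i ≢_) s → Unique s →
                Branch i j q
  branch-cons e S@(here _)   i∉ us = _ , step e S , i∉ ∷ us
  branch-cons e S@(step _ _) i∉ us = _ , step e S , i∉ ∷ us

  branch-cut : ∀ {i j q p y} → SimplePath T i q (i ∷ j ∷ p) → y ∈ₗ (j ∷ p) → Branch i j y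
  branch-cut (P , i∉ ∷ u) y∈ with prefix (proj₂ (uncons P)) u y∈
  ... | s , S , us , s⊆ = branch-cons (proj₁ (uncons P)) S (anti-mono s⊆ i∉) us

  branch-tail : ∀ {i j q} → Branch i j q → q ≢ j → ∃ λ l → l ≢ i × Branch j l q
  branch-tail ([] , P , _) q≢j = contradiction (trivial-path (proj₂ (uncons P))) q≢j
  branch-tail (l ∷ p , P , i∉ ∷ u) _ =
    l , (λ l≡i → All.lookup i∉ (there (here refl)) (≡-sym l≡i)) , p , proj₂ (uncons P) , u

  fork-cycle : ∀ {i j₁ j₂} → Branch i j₂ j₁ → Edge T i j₁ → j₁ ≢ j₂ → HasCycle T
  fork-cycle ([] , P , _)    e j₁≢j₂ = contradiction (trivial-path (proj₂ (uncons P))) j₁≢j₂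
  fork-cycle (_ ∷ _ , P , u) e _     = _ , _ , _ , (P , u) , s≤s (s≤s (s≤s z≤n)) , edge-sym e

-- In an acyclic graph, the first step of a simple path is determined by its ends

module Acyclic {k : ℕ} (T : Graph k) (acyclic : ¬ HasCycle T) where

  open Paths T

  -- If j₁ lies
  -- on the second path, the two close a cycle; otherwise start again from j₁, comparing
  -- the rest of the first path with the detour back through i.
  no-fork : ∀ {i j₁ j₂ q} p₁ {p₂} → SimplePath T i q (i ∷ j₁ ∷ p₁) →
            SimplePath T i q (i ∷ j₂ ∷ p₂) → j₁ ≢ j₂ → ⊥
  no-fork {i} {j₁} {j₂} p₁ {p₂} P Q j₁≢j₂ with j₁ ∈ₗ? (j₂ ∷ p₂)
  ... | yes j₁∈Q = acyclic (fork-cycle (branch-cut Q j₁∈Q) (branch-edge (p₁ , P)) j₁≢j₂)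
  ... | no  j₁∉Q = detour p₁ P
    where
    detour : ∀ p → SimplePath T i _ (i ∷ j₁ ∷ p) → ⊥
    detour [] (P , _) =
      j₁∉Q (subst (_∈ₗ (j₂ ∷ p₂)) (trivial-path (proj₂ (uncons P)))
                  (path-last (proj₂ (uncons (proj₁ Q)))))
    detour (l ∷ p) (P , i∉ ∷ u) =
      no-fork p (proj₂ (uncons P) , u)
        (step (edge-sym e₁) (proj₁ Q) , (edge-irrefl (edge-sym e₁) ∷ ¬Any⇒All¬ _ j₁∉Q) ∷ proj₂ Q)
        (λ l≡i → All.lookup i∉ (there (here refl)) (≡-sym l≡i))
      where e₁ = proj₁ (uncons P)

  branch-unique : ∀ {i j₁ j₂ q} → Branch i j₁ q → Branch i j₂ q → j₁ ≡ j₂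
  branch-unique {j₁ = j₁} {j₂} (p₁ , P) (_ , Q) with j₁ ≟ᶠ j₂
  ... | yes j₁≡j₂ = j₁≡j₂
  ... | no  j₁≢j₂ = ⊥-elim (no-fork p₁ P Q j₁≢j₂)

  branch-extend : ∀ {i j l q} → Edge T i j → Branch j l q → l ≢ i → Branch i j q
  branch-extend {i} {l = l} e (p , P , j∉ ∷ u) l≢i with i ∈ₗ? (l ∷ p)
  ... | yes i∈ =
    contradiction (branch-unique (branch-cut (P , j∉ ∷ u) i∈) (branch-neighbour (edge-sym e))) l≢i
  ... | no i∉ = l ∷ p , step e P , (edge-irrefl e ∷ ¬Any⇒All¬ _ i∉) ∷ j∉ ∷ u

  branch-separate : ∀ {i j₁ j₂ q₁ q₂} → Branch i j₁ q₁ → Branch i j₂ q₂ → j₁ ≢ j₂ →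
                    OnPath T q₁ q₂ i
  branch-separate {i} {j₁} {j₂} (p₁ , P , uP) (p₂ , Q , uQ) j₁≢j₂
    with Any.any? (_∈ₗ? (j₁ ∷ p₁)) (j₂ ∷ p₂)
  ... | yes common with find common
  ...   | y , y∈Q , y∈P =
    contradiction (branch-unique (branch-cut (P , uP) y∈P) (branch-cut (Q , uQ) y∈Q)) j₁≢j₂
  branch-separate {i} {j₁} {j₂} (p₁ , P , uP) (p₂ , Q , i∉Q ∷ uQ) j₁≢j₂
      | no disjoint =
    _ , (append (reverse-path P) (proj₁ (uncons Q)) (proj₂ (uncons Q)) ,
         ++⁺ (unique-reverse uP) uQ apart) ,
    ∈-++⁺ˡ (reverse⁺ {xs = i ∷ j₁ ∷ p₁} (here refl))
    where
    apart : ∀ {y} → ¬ (y ∈ₗ reverse (i ∷ j₁ ∷ p₁) × y ∈ₗ (j₂ ∷ p₂))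
    apart (y∈P , y∈Q) with reverse⁻ {xs = i ∷ j₁ ∷ p₁} y∈P
    ... | here refl  = All.lookup i∉Q y∈Q refl
    ... | there y∈P′ = disjoint (Any.map (λ { refl → y∈P′ }) y∈Q)

module ConnectedGraph {k : ℕ} (T : Graph k) (connected : Connected T) where

  open Paths T

  simple-path : ∀ a b → ∃ λ s → SimplePath T a b s
  simple-path a b = to-simple (proj₂ (connected a b))

  branch-exists : ∀ {i q} → q ≢ i → ∃ λ j → Branch i j q
  branch-exists {i} {q} q≢i with simple-path i q
  ... | _ , here _ , _              = contradiction refl q≢i
  ... | _ , step e (here _) , u     = _ , [] , step e (here _) , u
  ... | _ , step e (step e′ S) , u  = _ , _ , step e (step e′ S) , u

  orientation : ∀ r {i j} → Edge T i j → ChildOf T r i j ⊎ ChildOf T r j i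
  orientation r {i} {j} e with simple-path r j
  ... | s , S , u with i ∈ₗ? s
  ...   | yes i∈s = inj₁ (e , s , (S , u) , i∈s)
  ...   | no  i∉s = inj₂ (edge-sym e , s ++ [ i ] ,
                          (append S (edge-sym e) (here i) ,
                           ++⁺ u ([] ∷ []) λ { (i∈ , here refl) → i∉s i∈ }) ,
                          ∈-++⁺ˡ (path-last S))

module Tree {k : ℕ} (T : Graph k) (connected : Connected T) (acyclic : ¬ HasCycle T) where

  open Paths T
  open Acyclic T acyclic
  open ConnectedGraph T connected

  -- next i q is the first step from i towards q (its value for q = i is irrelevant).
  next : Fin k → Fin k → Fin k
  next i q with q ≟ᶠ i
  ... | yes _   = i
  ... | no q≢i = proj₁ (branch-exists q≢i)

  next-branch : ∀ {i q} → q ≢ i → Branch i (next i q) q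
  next-branch {i} {q} q≢i with q ≟ᶠ i
  ... | yes q≡i  = contradiction q≡i q≢i
  ... | no  q≢i′ = proj₂ (branch-exists q≢i′)

  next-unique : ∀ {i j q} → Branch i j q → next i q ≡ j
  next-unique b = branch-unique (next-branch (branch-source b)) b

descend : ∀ {M} (_⇝_ : Fin M → Fin M → Set) → (∀ i j → Dec (i ⇝ j)) →
  (μ : Fin M → Fin M → ℕ) → (∀ {i j l} → i ⇝ j → j ⇝ l → μ j l < μ i j) →
  Fin M → ∃ λ l → ∀ j → ¬ (l ⇝ j)
descend _⇝_ step? μ shrinks r with any? (step? r)
... | no  stuck  = r , λ j r⇝j → stuck (j , r⇝j)
... | yes (j , r⇝j) = walk (suc (μ r j)) r⇝j ≤-refl
  where
  walk : ∀ b {i j} → i ⇝ j → μ i j < b → ∃ λ l → ∀ j → ¬ (l ⇝ j)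
  walk zero    _   ()
  walk (suc b) {j = j} i⇝j μ<b with any? (step? j)
  ... | no  stuck      = j , λ l j⇝l → stuck (l , j⇝l)
  ... | yes (l , j⇝l) = walk b j⇝l (<-≤-trans (shrinks i⇝j j⇝l) (≤-pred μ<b))

class? : ∀ {n M} (Y : Subset n) (c : Fin n → Fin M) j v → Dec (v ∉ Y × c v ≡ j)
class? Y c j v = ¬? (v ∈? Y) ×-dec (c v ≟ᶠ j)

Class : ∀ {n M} (Y : Subset n) (c : Fin n → Fin M) → Fin M → Subset n
Class Y c j = select (class? Y c j)

last-failure : ∀ {P : ℕ → Set} → (∀ s → Dec (P s)) → ¬ P 0 →
               ∀ M → ∃ λ s → ¬ P s × (s ≡ M ⊎ P (suc s))
last-failure P? ¬P0 zero = 0 , ¬P0 , inj₁ refl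
last-failure P? ¬P0 (suc M) with last-failure P? ¬P0 M
... | s , ¬Ps , inj₂ Ps+1 = s , ¬Ps , inj₂ Ps+1
... | s , ¬Ps , inj₁ refl with P? (suc s)
...   | yes Ps+1  = s , ¬Ps , inj₂ Ps+1
...   | no  ¬Ps+1 = suc s , ¬Ps+1 , inj₁ refl

module Threshold {n M : ℕ} (Y : Subset n) (c : Fin n → Fin M) where

  below? : ∀ s v → Dec (v ∉ Y × toℕ (c v) < s)
  below? s v = ¬? (v ∈? Y) ×-dec (toℕ (c v) <? s)

  at? : ∀ s v → Dec (v ∉ Y × toℕ (c v) ≡ s)
  at? s v = ¬? (v ∈? Y) ×-dec (toℕ (c v) ≟ s)

  above? : ∀ s v → Dec (v ∉ Y × s < toℕ (c v))
  above? s v = ¬? (v ∈? Y) ×-dec (s <? toℕ (c v))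

  Below At Above : ℕ → Subset n
  Below s = select (below? s)
  At    s = select (at? s)
  Above s = select (above? s)

  three-split : ∀ (G : Graph n) → (∀ {u v} → u ∉ Y → v ∉ Y → Edge G u v → c u ≡ c v) →
                ∀ s → ThreeSplit G Y (Below s) (At s) (Above s)
  three-split G same s =
    covers ,
    (λ v → outside-below) , (λ v → outside-at) , (λ v → outside-above) ,
    (λ v v∈B v∈A → <-irrefl (label-at v∈A) (label-below v∈B)) ,
    (λ v v∈B v∈C → <-asym (label-below v∈B) (label-above v∈C)) ,
    (λ v v∈A v∈C → <-irrefl (≡-sym (label-at v∈A)) (label-above v∈C)) ,
    (λ u v u∈B v∈A e → <-irrefl (trans (edge-label (outside-below u∈B) (outside-at v∈A) e)
                                        (label-at v∈A))
                                 (label-below u∈B)) ,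
    (λ u v u∈B v∈C e → <-asym (label-below u∈B)
                         (subst (s <_)
                                (≡-sym (edge-label (outside-below u∈B) (outside-above v∈C) e))
                                (label-above v∈C))) ,
    (λ u v u∈A v∈C e → <-irrefl (trans (≡-sym (label-at u∈A))
                                        (edge-label (outside-at u∈A) (outside-above v∈C) e))
                                 (label-above v∈C))
    where
    outside-below : ∀ {v} → v ∈ Below s → v ∉ Y
    outside-below = proj₁ ∘ select⁻ (below? s)
    outside-at : ∀ {v} → v ∈ At s → v ∉ Y
    outside-at = proj₁ ∘ select⁻ (at? s)
    outside-above : ∀ {v} → v ∈ Above s → v ∉ Y
    outside-above = proj₁ ∘ select⁻ (above? s)
    label-below : ∀ {v} → v ∈ Below s → toℕ (c v) < s
    label-below = proj₂ ∘ select⁻ (below? s)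
    label-at : ∀ {v} → v ∈ At s → toℕ (c v) ≡ s
    label-at = proj₂ ∘ select⁻ (at? s)
    label-above : ∀ {v} → v ∈ Above s → s < toℕ (c v)
    label-above = proj₂ ∘ select⁻ (above? s)
    edge-label : ∀ {u v} → u ∉ Y → v ∉ Y → Edge G u v → toℕ (c u) ≡ toℕ (c v)
    edge-label u∉Y v∉Y e = cong toℕ (same u∉Y v∉Y e)
    covers : ∀ v → v ∉ Y → v ∈ Below s ⊎ v ∈ At s ⊎ v ∈ Above s
    covers v v∉Y with <-cmp (toℕ (c v)) s
    ... | tri< lt _ _ = inj₁ (select⁺ (below? s) (v∉Y , lt))
    ... | tri≈ _ eq _ = inj₂ (inj₁ (select⁺ (at? s) (v∉Y , eq)))
    ... | tri> _ _ gt = inj₂ (inj₂ (select⁺ (above? s) (v∉Y , gt)))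

  nothing-below-0 : ¬ Heavy Y (Below 0)
  nothing-below-0 = ≤⇒≯ (empty-fits Y (Below 0) λ v v∈ → n≮0 (proj₂ (select⁻ (below? 0) v∈)))

  -- At s lies within a single class (or is empty when s is not a label).
  at-fits : (∀ j → Fits Y (Class Y c j)) → ∀ s → Fits Y (At s)
  at-fits class-fits s with s <? M
  ... | yes s<M = ≤-trans (*-monoʳ-≤ 2 (p⊆q⇒∣p∣≤∣q∣ in-class)) (class-fits (fromℕ< s<M))
    where
    in-class : At s ⊆ Class Y c (fromℕ< s<M)
    in-class v∈ with select⁻ (at? s) v∈
    ... | v∉Y , label≡s =
      select⁺ (class? Y c (fromℕ< s<M))
              (v∉Y , toℕ-injective (trans label≡s (≡-sym (toℕ-fromℕ< s<M))))
  ... | no s≮M = empty-fits Y (At s) λ v v∈ →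
    s≮M (subst (_< M) (proj₂ (select⁻ (at? s) v∈)) (toℕ<n (c v)))

  -- Above s is empty when s = M, and disjoint from Below (s + 1) otherwise.
  above-fits : ∀ s → s ≡ M ⊎ Heavy Y (Below (suc s)) → Fits Y (Above s)
  above-fits s (inj₁ refl) = empty-fits Y (Above s) λ v v∈ →
    <-asym (proj₂ (select⁻ (above? s) v∈)) (toℕ<n (c v))
  above-fits s (inj₂ heavy) =
    rest-fits Y (Above s) (Below (suc s))
      (x∉p⇒x∈∁p ∘ proj₁ ∘ select⁻ (above? s)) (x∉p⇒x∈∁p ∘ proj₁ ∘ select⁻ (below? (suc s)))
      (λ v∈B v∈A → <-irrefl refl (≤-trans (proj₂ (select⁻ (above? s) v∈A))
                                        (≤-pred (proj₂ (select⁻ (below? (suc s)) v∈B)))))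
      heavy

  -- If every class fits outside Y, then some threshold makes all three pieces fit: take
  -- the last s for which Below s is not heavy.
  balanced-threshold : (∀ j → Fits Y (Class Y c j)) →
                       ∃ λ s → Fits Y (Below s) × Fits Y (At s) × Fits Y (Above s)
  balanced-threshold class-fits
    with last-failure (λ s → heavy? Y (Below s)) nothing-below-0 M
  ... | s , not-heavy , last = s , ≮⇒≥ not-heavy , at-fits class-fits s , above-fits s last

module Decomposition {n : ℕ} {G : Graph n} (D : TreeDecomposition G) where

  private
    k : ℕ
    k = m D
    connected : Connected (T D)
    connected = proj₁ (proj₂ (tree D))
    acyclic : ¬ HasCycle (T D)
    acyclic = proj₂ (proj₂ (tree D))

  open Paths (T D)
  open Acyclic (T D) acyclic
  open ConnectedGraph (T D) connected
  open Tree (T D) connected acyclic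

  home : Fin n → Fin k
  home v = proj₁ (cover D v)

  side : Fin k → Fin n → Fin k
  side i v = next i (home v)

  -- For v outside X_i, every bag containing v lies in the same branch at i: otherwise
  -- i would lie between two bags containing v, and coherence would put v into X_i.
  bag-side : ∀ {i q v} → v ∉ X D i → v ∈ X D q → next i q ≡ side i v
  bag-side {i} {q} {v} v∉Xi v∈Xq with next i q ≟ᶠ side i v
  ... | yes same = same
  ... | no  different = contradiction
    (coherent D q i (home v)
       (branch-separate (next-branch q≢i) (next-branch home≢i) different)
       v v∈Xq (proj₂ (cover D v)))
    v∉Xi
    where
    q≢i : q ≢ i
    q≢i refl = v∉Xi v∈Xq
    home≢i : home v ≢ i
    home≢i refl = v∉Xi (proj₂ (cover D v))

  edge-side : ∀ {i u v} → u ∉ X D i → v ∉ X D i → Edge G u v → side i u ≡ side i v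
  edge-side u∉ v∉ e with edgeCover D _ _ e
  ... | b , u∈b , v∈b = trans (≡-sym (bag-side u∉ u∈b)) (bag-side v∉ v∈b)

  Beyond : Fin k → Fin k → Subset n
  Beyond i j = Class (X D i) (side i) j

  beyond⁻ : ∀ {i j v} → v ∈ Beyond i j → v ∉ X D i × side i v ≡ j
  beyond⁻ {i} {j} = select⁻ (class? (X D i) (side i) j)

  beyond-branch : ∀ {i j v} → v ∈ Beyond i j → Branch i j (home v)
  beyond-branch {v = v} v∈ with beyond⁻ v∈
  ... | v∉Xi , refl = next-branch (λ { refl → v∉Xi (proj₂ (cover D v)) })

  -- Beyond i j and Beyond j i are disjoint: seen from j, the bags of a vertex beyond j
  -- lie further away from i.
  beyond-disjoint : ∀ {i j v} → v ∈ Beyond i j → v ∉ Beyond j i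
  beyond-disjoint {v = v} v∈ij v∈ji with beyond⁻ v∈ji
  ... | v∉Xj , next≡i
    with branch-tail (beyond-branch v∈ij) (λ { refl → v∉Xj (proj₂ (cover D v)) })
  ...   | l , l≢i , b = l≢i (trans (≡-sym (next-unique b)) next≡i)

  HeavyBranch : Fin k → Fin k → Set
  HeavyBranch i j = Heavy (X D i) (Beyond i j)

  heavy-edge : ∀ {i j} → HeavyBranch i j → Edge (T D) i j
  heavy-edge {i} {j} heavy =
    branch-edge (beyond-branch (proj₂ (heavy-element (X D i) (Beyond i j) heavy)))

  nodes? : ∀ i j q → Dec (q ≢ i × next i q ≡ j)
  nodes? i j q = ¬? (q ≟ᶠ i) ×-dec (next i q ≟ᶠ j)

  Nodes : Fin k → Fin k → Subset k
  Nodes i j = select (nodes? i j)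

  nodes⁺ : ∀ {i j q} → Branch i j q → q ∈ Nodes i j
  nodes⁺ {i} {j} b = select⁺ (nodes? i j) (branch-source b , next-unique b)

  nodes⁻ : ∀ {i j q} → q ∈ Nodes i j → Branch i j q
  nodes⁻ {i} {j} q∈ with select⁻ (nodes? i j) q∈
  ... | q≢i , refl = next-branch q≢i

  module Normalized (r : Fin k) (normalized : IsNormalized D r) where

    neighbour-bags : ∀ {i j} → Edge (T D) i j → ∣ (X D j ─ X D i) ∪ (X D i ─ X D j) ∣ ≡ 1
    neighbour-bags {i} {j} e with orientation r e
    ... | inj₁ j-child = proj₂ normalized i j j-child
    ... | inj₂ i-child = trans (cong ∣_∣ (∪-comm (X D j ─ X D i) (X D i ─ X D j)))
                               (proj₂ normalized j i i-child)

    no-mutual-heavy : ∀ {i j} → HeavyBranch i j → HeavyBranch j i → ⊥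
    no-mutual-heavy {i} {j} heavy₁ heavy₂ =
      not-both-heavy (X D i) (X D j) (Beyond i j) (Beyond j i)
        (neighbour-bags (heavy-edge heavy₁))
        (proj₁ ∘ beyond⁻) (proj₁ ∘ beyond⁻) beyond-disjoint heavy₁ heavy₂

    -- Two consecutive heavy steps i → j → l never return (l ≠ i), so the branch shrinks.
    branch-shrinks : ∀ {i j l} → HeavyBranch i j → HeavyBranch j l →
                     ∣ Nodes j l ∣ < ∣ Nodes i j ∣
    branch-shrinks {i} {j} {l} heavy₁ heavy₂ =
      p⊂q⇒∣p∣<∣q∣ (inner , j , nodes⁺ (branch-neighbour e) , λ j∈ → branch-source (nodes⁻ j∈) refl)
      where
      e : Edge (T D) i j
      e = heavy-edge heavy₁
      l≢i : l ≢ i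
      l≢i refl = no-mutual-heavy heavy₁ heavy₂
      inner : Nodes j l ⊆ Nodes i j
      inner q∈ = nodes⁺ (branch-extend e (nodes⁻ q∈) l≢i)

    light-node : ∃ λ l → ∀ j → ¬ HeavyBranch l j
    light-node = descend HeavyBranch (λ i j → heavy? (X D i) (Beyond i j))
                         (λ i j → ∣ Nodes i j ∣) branch-shrinks r

lemma4 : ∀ (n : ℕ) (G : Graph n) (t : ℕ) → HasTreewidth G t →
    (D : TreeDecomposition G) → HasWidth D t →
    (r : Fin (m D)) → IsNormalized D r →
    Σ (Fin (m D)) λ l → Σ (Subset n) λ S₁ → Σ (Subset n) λ S₂ → Σ (Subset n) λ S₃ →
    ThreeSplit G (X D l) S₁ S₂ S₃ ×
    (2 * ∣ S₁ ∣ ≤ (n ∸ ∣ X D l ∣) + 1) ×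
    (2 * ∣ S₂ ∣ ≤ (n ∸ ∣ X D l ∣) + 1) ×
    (2 * ∣ S₃ ∣ ≤ (n ∸ ∣ X D l ∣) + 1)
lemma4 n G t _ D _ r normalized =
  l , Below s , At s , Above s , three-split G edge-side s ,
  room (Below s) fits₁ , room (At s) fits₂ , room (Above s) fits₃
  where
  open Decomposition D
  open Normalized r normalized
  l : Fin (m D)
  l = proj₁ light-node
  open Threshold (X D l) (side l)
  balanced : ∃ λ s → Fits (X D l) (Below s) × Fits (X D l) (At s) × Fits (X D l) (Above s)
  balanced = balanced-threshold (λ j → ≮⇒≥ (proj₂ light-node j))
  s : ℕ
  s = proj₁ balanced
  fits₁ : Fits (X D l) (Below s)
  fits₁ = proj₁ (proj₂ balanced)
  fits₂ : Fits (X D l) (At s)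
  fits₂ = proj₁ (proj₂ (proj₂ balanced))
  fits₃ : Fits (X D l) (Above s)
  fits₃ = proj₂ (proj₂ (proj₂ balanced))
  room : ∀ S → Fits (X D l) S → 2 * ∣ S ∣ ≤ (n ∸ ∣ X D l ∣) + 1
  room S = subst (λ N → 2 * ∣ S ∣ ≤ N + 1) (∣∁p∣≡n∸∣p∣ (X D l))
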